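{- For integers $n\ge 0$ and $k$, define $$g(n,k)=\sum_{j\in\mathbb{Z}} q^{2j^2-j}\begin{bmatrix} \lceil n/2\rceil\\ k+j\end{bmatrix}_{q^2}\begin{bmatrix} \lfloor n/2\rfloor\\ k-j\end{bmatrix}_{q^2}.$$ Then $g(n,k)=\begin{bmatrix} n\\ 2k\end{bmatrix}_q$ for all $n\ge 0$ and all $k$.
   Context: $q$ is an indeterminate. For a base $p$ (here $p=q$ or $p=q^2$) and integers $n,k$, $\begin{bmatrix} n\\ k\end{bmatrix}_p$ denotes the Gaussian binomial coefficient $\frac{(p;p)_n}{(p;p)_k(p;p)_{n-k}}$ for $0\le k\le n$ and $0$ otherwise, where $(x;p)_m=(1-x)(1-xp)\cdots(1-xp^{m-1})$. -}

module Defs where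

open import Level using (Level)
open import Algebra.Bundles using (CommutativeRing)
open import Data.Nat using (ℕ; zero; suc; ⌊_/2⌋; ⌈_/2⌉)
open import Data.Integer as ℤ using (ℤ; +_; -[1+_]; ∣_∣)

module _ {c ℓ : Level} (R : CommutativeRing c ℓ) where
  open CommutativeRing R using (Carrier; _+_; _*_; 0#; 1#)

  pow : Carrier → ℕ → Carrier
  pow x zero    = 1#
  pow x (suc n) = x * pow x n

  -- Gaussian binomial [n k]_p, defined by the q-Pascal recurrence
  --   [0 0] = 1, [0 k+1] = 0, [n+1 0] = 1,
  --   [n+1 k+1] = [n k] + p^(k+1) [n k+1],
  -- which yields (p;p)_n / ((p;p)_k (p;p)_(n-k)) for 0 ≤ k ≤ n and 0 for k > n.
  gauss : Carrier → ℕ → ℕ → Carrier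
  gauss p zero    zero    = 1#
  gauss p zero    (suc k) = 0#
  gauss p (suc n) zero    = 1#
  gauss p (suc n) (suc k) = gauss p n k + pow p (suc k) * gauss p n (suc k)

  gaussℤ : Carrier → ℕ → ℤ → Carrier
  gaussℤ p n (+ k)    = gauss p n k
  gaussℤ p n -[1+ k ] = 0#

  sumTo : ℕ → (ℕ → Carrier) → Carrier
  sumTo zero    f = f zero
  sumTo (suc m) f = sumTo m f + f (suc m)

  -- Only j with 0 ≤ k+j ≤ ⌈n/2⌉ can contribute (otherwise the first factor is 0),
  -- so we sum over i = k+j ∈ {0,…,⌈n/2⌉}, i.e. j = i - k.
  -- The exponent 2j²-j = j(2j-1) is always ≥ 0, so it equals ∣ j(2j-1) ∣.
  gTerm : Carrier → ℕ → ℤ → ℕ → Carrier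
  gTerm q n k i =
    let j = + i ℤ.- k in
    pow q ∣ j ℤ.* (+ 2 ℤ.* j ℤ.- + 1) ∣
      * (gaussℤ (q * q) ⌈ n /2⌉ (k ℤ.+ j) * gaussℤ (q * q) ⌊ n /2⌋ (k ℤ.- j))

  g : Carrier → ℕ → ℤ → Carrier
  g q n k = sumTo ⌈ n /2⌉ (gTerm q n k)

{-# OPTIONS --safe #-}
module Submission where

open import Defs
open import Level using (Level)
open import Algebra.Bundles using (CommutativeRing)
open import Data.Nat using (ℕ)
open import Data.Integer using (ℤ; +_; _*_)

open import Data.Nat.Base as ℕ using (zero; suc; _<_; s≤s; ⌊_/2⌋; ⌈_/2⌉)
import Data.Nat.Properties as ℕ
import Data.Integer.Base as ℤ
import Data.Integer.Properties as ℤ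
open import Data.Integer.Tactic.RingSolver using (solve-∀)
open import Function.Base using (flip; _∘_)
open import Relation.Binary.PropositionalEquality as ≡ using (_≡_)
import Relation.Binary.Reasoning.Setoid as SetoidReasoning

-- For all N, not only even ones, consider
--   F(a, b, N) = Σ_{i + i' = N} q^C(i - i', 2) [a, i]_{q²} [b, i']_{q²}.
-- Splitting [b + 1, i]_{q²} by the q-Pascal rule and using C(i + 1 - i', 2) = C(i' - i, 2) and
-- q^C(i' - i, 2) q^(2i') = q^(i + i') q^C(i - i', 2) gives
--   F(b + 1, a, N + 1) = F(a, b, N) + q^(N + 1) F(a, b, N + 1).
-- As (⌈(n+1)/2⌉, ⌊(n+1)/2⌋) = (⌊n/2⌋ + 1, ⌈n/2⌉), this is the q-Pascal recurrence of [n, N]_q for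
-- (a, b) = (⌈n/2⌉, ⌊n/2⌋), so F(⌈n/2⌉, ⌊n/2⌋, N) = [n, N]_q. The theorem is the case N = 2k with
-- (i, i') = (k + j, k - j), where C(i - i', 2) = 2j² - j; for k < 0 every term has i' < 0 and vanishes.

diffChoose2 : ℕ → ℕ → ℕ
diffChoose2 zero    zero    = 0
diffChoose2 zero    (suc j) = suc j ℕ.+ diffChoose2 zero j
diffChoose2 (suc i) zero    = i ℕ.+ diffChoose2 i zero
diffChoose2 (suc i) (suc j) = diffChoose2 i j

private
  double-+ : ∀ a {d x} → + 2 ℤ.* + d ≡ x → + 2 ℤ.* + (a ℕ.+ d) ≡ + 2 ℤ.* + a ℤ.+ x
  double-+ a {d} ≡.refl = ≡.trans (≡.cong (+ 2 ℤ.*_) (ℤ.pos-+ a d)) (ℤ.*-distribˡ-+ (+ 2) (+ a) (+ d))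

  double-injective : ∀ {m n} → + 2 ℤ.* + m ≡ + 2 ℤ.* + n → m ≡ n
  double-injective e = ℤ.+-injective (ℤ.*-cancelˡ-≡ (+ 2) _ _ e)

double-diffChoose2 : ∀ i j →
  + 2 ℤ.* + diffChoose2 i j ≡ (+ i ℤ.- + j) ℤ.* (+ i ℤ.- + j ℤ.- + 1)
double-diffChoose2 zero    zero    = ≡.refl
double-diffChoose2 zero    (suc j) =
  ≡.trans (double-+ (suc j) (double-diffChoose2 zero j)) (identity (+ j))
  where
  identity : ∀ x → + 2 ℤ.* (+ 1 ℤ.+ x) ℤ.+ (+ 0 ℤ.- x) ℤ.* (+ 0 ℤ.- x ℤ.- + 1)
                 ≡ (+ 0 ℤ.- (+ 1 ℤ.+ x)) ℤ.* (+ 0 ℤ.- (+ 1 ℤ.+ x) ℤ.- + 1)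
  identity = solve-∀
double-diffChoose2 (suc i) zero    =
  ≡.trans (double-+ i (double-diffChoose2 i zero)) (identity (+ i))
  where
  identity : ∀ x → + 2 ℤ.* x ℤ.+ (x ℤ.- + 0) ℤ.* (x ℤ.- + 0 ℤ.- + 1)
                 ≡ (+ 1 ℤ.+ x ℤ.- + 0) ℤ.* (+ 1 ℤ.+ x ℤ.- + 0 ℤ.- + 1)
  identity = solve-∀
double-diffChoose2 (suc i) (suc j) =
  ≡.trans (double-diffChoose2 i j) (identity (+ i) (+ j))
  where
  identity : ∀ x y → (x ℤ.- y) ℤ.* (x ℤ.- y ℤ.- + 1)
                   ≡ (+ 1 ℤ.+ x ℤ.- (+ 1 ℤ.+ y)) ℤ.* (+ 1 ℤ.+ x ℤ.- (+ 1 ℤ.+ y) ℤ.- + 1)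
  identity = solve-∀

diffChoose2-reflect : ∀ i j → diffChoose2 (suc i) j ≡ diffChoose2 j i
diffChoose2-reflect i j = double-injective (begin
  + 2 ℤ.* + diffChoose2 (suc i) j                    ≡⟨ double-diffChoose2 (suc i) j ⟩
  (+ suc i ℤ.- + j) ℤ.* (+ suc i ℤ.- + j ℤ.- + 1)    ≡⟨ identity (+ i) (+ j) ⟩
  (+ j ℤ.- + i) ℤ.* (+ j ℤ.- + i ℤ.- + 1)            ≡⟨ double-diffChoose2 j i ⟨
  + 2 ℤ.* + diffChoose2 j i                          ∎)
  where
  open ≡.≡-Reasoning
  identity : ∀ x y → (+ 1 ℤ.+ x ℤ.- y) ℤ.* (+ 1 ℤ.+ x ℤ.- y ℤ.- + 1) ≡ (y ℤ.- x) ℤ.* (y ℤ.- x ℤ.- + 1)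
  identity = solve-∀

diffChoose2-swap : ∀ i j → (j ℕ.+ j) ℕ.+ diffChoose2 j i ≡ (i ℕ.+ j) ℕ.+ diffChoose2 i j
diffChoose2-swap i j = double-injective (begin
  + 2 ℤ.* + ((j ℕ.+ j) ℕ.+ diffChoose2 j i)
    ≡⟨ double-+ (j ℕ.+ j) (double-diffChoose2 j i) ⟩
  + 2 ℤ.* (+ j ℤ.+ + j) ℤ.+ (+ j ℤ.- + i) ℤ.* (+ j ℤ.- + i ℤ.- + 1)
    ≡⟨ identity (+ i) (+ j) ⟩
  + 2 ℤ.* (+ i ℤ.+ + j) ℤ.+ (+ i ℤ.- + j) ℤ.* (+ i ℤ.- + j ℤ.- + 1)
    ≡⟨ double-+ (i ℕ.+ j) (double-diffChoose2 i j) ⟨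
  + 2 ℤ.* + ((i ℕ.+ j) ℕ.+ diffChoose2 i j) ∎)
  where
  open ≡.≡-Reasoning
  identity : ∀ x y → + 2 ℤ.* (y ℤ.+ y) ℤ.+ (y ℤ.- x) ℤ.* (y ℤ.- x ℤ.- + 1)
                   ≡ + 2 ℤ.* (x ℤ.+ y) ℤ.+ (x ℤ.- y) ℤ.* (x ℤ.- y ℤ.- + 1)
  identity = solve-∀

i+[j-i]≡j : ∀ i j → i ℤ.+ (j ℤ.- i) ≡ j
i+[j-i]≡j = solve-∀

module _ (i j K : ℕ) (i+j≡K+K : i ℕ.+ j ≡ K ℕ.+ K) where
  open ≡.≡-Reasoning

  private
    +j≡K+K-i : + j ≡ (+ K ℤ.+ + K) ℤ.- + i
    +j≡K+K-i = begin
      + j                       ≡⟨ identity (+ i) (+ j) ⟩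
      (+ i ℤ.+ + j) ℤ.- + i     ≡⟨ ≡.cong (λ m → + m ℤ.- + i) i+j≡K+K ⟩
      (+ K ℤ.+ + K) ℤ.- + i     ∎
      where
      identity : ∀ x y → y ≡ (x ℤ.+ y) ℤ.- x
      identity = solve-∀

  centred-difference : + K ℤ.- (+ i ℤ.- + K) ≡ + j
  centred-difference = ≡.trans (identity (+ i) (+ K)) (≡.sym +j≡K+K-i)
    where
    identity : ∀ x k → k ℤ.- (x ℤ.- k) ≡ (k ℤ.+ k) ℤ.- x
    identity = solve-∀

  centred-exponent : ℤ.∣ (+ i ℤ.- + K) ℤ.* (+ 2 ℤ.* (+ i ℤ.- + K) ℤ.- + 1) ∣ ≡ diffChoose2 i j
  centred-exponent = ≡.cong ℤ.∣_∣ (ℤ.*-cancelˡ-≡ (+ 2) _ _ (begin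
    + 2 ℤ.* ((+ i ℤ.- + K) ℤ.* (+ 2 ℤ.* (+ i ℤ.- + K) ℤ.- + 1))
      ≡⟨ identity (+ i) (+ K) ⟩
    (+ i ℤ.- ((+ K ℤ.+ + K) ℤ.- + i)) ℤ.* (+ i ℤ.- ((+ K ℤ.+ + K) ℤ.- + i) ℤ.- + 1)
      ≡⟨ ≡.cong (λ y → (+ i ℤ.- y) ℤ.* (+ i ℤ.- y ℤ.- + 1)) +j≡K+K-i ⟨
    (+ i ℤ.- + j) ℤ.* (+ i ℤ.- + j ℤ.- + 1)
      ≡⟨ double-diffChoose2 i j ⟨
    + 2 ℤ.* + diffChoose2 i j ∎))
    where
    identity : ∀ x k → + 2 ℤ.* ((x ℤ.- k) ℤ.* (+ 2 ℤ.* (x ℤ.- k) ℤ.- + 1))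
                     ≡ (x ℤ.- ((k ℤ.+ k) ℤ.- x)) ℤ.* (x ℤ.- ((k ℤ.+ k) ℤ.- x) ℤ.- + 1)
    identity = solve-∀

module _ {c ℓ : Level} (R : CommutativeRing c ℓ) where
  open CommutativeRing R renaming (_*_ to _·_)
  open import Algebra.Properties.CommutativeSemiring.Exp commutativeSemiring
    using (_^_; ^-homo-*; ^-distrib-*)
  open import Algebra.Properties.CommutativeSemigroup +-commutativeSemigroup
    using (interchange; x∙yz≈y∙xz)
  open SetoidReasoning setoid

  pow≡^ : ∀ x n → pow R x n ≡ x ^ n
  pow≡^ x zero    = ≡.refl
  pow≡^ x (suc n) = ≡.cong (x ·_) (pow≡^ x n)

  pow-homo-* : ∀ x m n → pow R x (m ℕ.+ n) ≈ pow R x m · pow R x n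
  pow-homo-* x m n = begin
    pow R x (m ℕ.+ n)      ≡⟨ pow≡^ x (m ℕ.+ n) ⟩
    x ^ (m ℕ.+ n)          ≈⟨ ^-homo-* x m n ⟩
    x ^ m · x ^ n          ≡⟨ ≡.cong₂ _·_ (pow≡^ x m) (pow≡^ x n) ⟨
    pow R x m · pow R x n  ∎

  pow-square : ∀ x n → pow R (x · x) n ≈ pow R x (n ℕ.+ n)
  pow-square x n = begin
    pow R (x · x) n    ≡⟨ pow≡^ (x · x) n ⟩
    (x · x) ^ n        ≈⟨ ^-distrib-* x x n ⟩
    x ^ n · x ^ n      ≈⟨ ^-homo-* x n n ⟨
    x ^ (n ℕ.+ n)      ≡⟨ pow≡^ x (n ℕ.+ n) ⟨
    pow R x (n ℕ.+ n)  ∎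

  factor-zeroˡ : ∀ {x y z} → y ≈ 0# → x · (y · z) ≈ 0#
  factor-zeroˡ {x} {y} {z} y≈0 = begin
    x · (y · z)   ≈⟨ *-congˡ (*-congʳ y≈0) ⟩
    x · (0# · z)  ≈⟨ *-congˡ (zeroˡ z) ⟩
    x · 0#        ≈⟨ zeroʳ x ⟩
    0#            ∎

  factor-zeroʳ : ∀ {x y z} → z ≈ 0# → x · (y · z) ≈ 0#
  factor-zeroʳ {x} {y} {z} z≈0 = begin
    x · (y · z)   ≈⟨ *-congˡ (*-congˡ z≈0) ⟩
    x · (y · 0#)  ≈⟨ *-congˡ (zeroʳ y) ⟩
    x · 0#        ≈⟨ zeroʳ x ⟩
    0#            ∎

  gauss-n-0≡1 : ∀ p n → gauss R p n 0 ≡ 1#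
  gauss-n-0≡1 p zero    = ≡.refl
  gauss-n-0≡1 p (suc n) = ≡.refl

  n<k⇒gauss≈0 : ∀ p {n k} → n < k → gauss R p n k ≈ 0#
  n<k⇒gauss≈0 p {zero}  {suc k} _         = refl
  n<k⇒gauss≈0 p {suc n} {suc k} (s≤s n<k) = begin
    gauss R p n k + pow R p (suc k) · gauss R p n (suc k)
      ≈⟨ +-cong (n<k⇒gauss≈0 p n<k) (*-congˡ (n<k⇒gauss≈0 p (ℕ.m<n⇒m<1+n n<k))) ⟩
    0# + pow R p (suc k) · 0#
      ≈⟨ +-identityˡ _ ⟩
    pow R p (suc k) · 0#
      ≈⟨ zeroʳ _ ⟩
    0# ∎

  sumTo-suc : ∀ N h → sumTo R (suc N) h ≈ h 0 + sumTo R N (h ∘ suc)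
  sumTo-suc zero    h = refl
  sumTo-suc (suc N) h = trans (+-congʳ (sumTo-suc N h)) (+-assoc _ _ _)

  sumTo-zero : ∀ N {h} → (∀ i → h i ≈ 0#) → sumTo R N h ≈ 0#
  sumTo-zero zero    h≈0 = h≈0 0
  sumTo-zero (suc N) h≈0 = trans (+-cong (sumTo-zero N h≈0) (h≈0 (suc N))) (+-identityˡ 0#)

  sumTo-extend : ∀ A {h} → (∀ d → h (suc d ℕ.+ A) ≈ 0#) → ∀ d → sumTo R A h ≈ sumTo R (d ℕ.+ A) h
  sumTo-extend A         h≈0 zero    = refl
  sumTo-extend A {h = h} h≈0 (suc d) = begin
    sumTo R A h                            ≈⟨ +-identityʳ _ ⟨
    sumTo R A h + 0#                       ≈⟨ +-cong (sumTo-extend A h≈0 d) (sym (h≈0 d)) ⟩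
    sumTo R (d ℕ.+ A) h + h (suc d ℕ.+ A)  ∎

  sumTo-resize : ∀ A B {h} → (∀ d → h (suc d ℕ.+ A) ≈ 0#) → (∀ d → h (suc d ℕ.+ B) ≈ 0#) →
                 sumTo R A h ≈ sumTo R B h
  sumTo-resize A B {h} h≈0-beyond-A h≈0-beyond-B = begin
    sumTo R A h          ≈⟨ sumTo-extend A h≈0-beyond-A B ⟩
    sumTo R (B ℕ.+ A) h  ≡⟨ ≡.cong (λ N → sumTo R N h) (ℕ.+-comm B A) ⟩
    sumTo R (A ℕ.+ B) h  ≈⟨ sumTo-extend B h≈0-beyond-B A ⟨
    sumTo R B h          ∎

  antidiagonalSum : ℕ → (ℕ → ℕ → Carrier) → Carrier
  antidiagonalSum zero    f = f 0 0
  antidiagonalSum (suc N) f = f 0 (suc N) + antidiagonalSum N (f ∘ suc)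

  antidiagonalSum-cong : ∀ N {f g} → (∀ i j → i ℕ.+ j ≡ N → f i j ≈ g i j) →
                         antidiagonalSum N f ≈ antidiagonalSum N g
  antidiagonalSum-cong zero    f≈g = f≈g 0 0 ≡.refl
  antidiagonalSum-cong (suc N) f≈g =
    +-cong (f≈g 0 (suc N) ≡.refl) (antidiagonalSum-cong N (λ i j e → f≈g (suc i) j (≡.cong suc e)))

  antidiagonalSum-zero : ∀ N {f} → (∀ i j → i ℕ.+ j ≡ N → f i j ≈ 0#) → antidiagonalSum N f ≈ 0#
  antidiagonalSum-zero zero    f≈0 = f≈0 0 0 ≡.refl
  antidiagonalSum-zero (suc N) f≈0 =
    trans (+-cong (f≈0 0 (suc N) ≡.refl)
                  (antidiagonalSum-zero N (λ i j e → f≈0 (suc i) j (≡.cong suc e))))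
          (+-identityˡ 0#)

  antidiagonalSum-distrib-+ : ∀ N f g →
    antidiagonalSum N (λ i j → f i j + g i j) ≈ antidiagonalSum N f + antidiagonalSum N g
  antidiagonalSum-distrib-+ zero    f g = refl
  antidiagonalSum-distrib-+ (suc N) f g =
    trans (+-congˡ (antidiagonalSum-distrib-+ N (f ∘ suc) (g ∘ suc))) (interchange _ _ _ _)

  *-distribˡ-antidiagonalSum : ∀ N x f → x · antidiagonalSum N f ≈ antidiagonalSum N (λ i j → x · f i j)
  *-distribˡ-antidiagonalSum zero    x f = refl
  *-distribˡ-antidiagonalSum (suc N) x f =
    trans (distribˡ x _ _) (+-congˡ (*-distribˡ-antidiagonalSum N x (f ∘ suc)))

  antidiagonalSum-sucʳ : ∀ N f →
    antidiagonalSum (suc N) f ≈ antidiagonalSum N (λ i j → f i (suc j)) + f (suc N) 0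
  antidiagonalSum-sucʳ zero    f = refl
  antidiagonalSum-sucʳ (suc N) f =
    trans (+-congˡ (antidiagonalSum-sucʳ N (f ∘ suc))) (sym (+-assoc _ _ _))

  antidiagonalSum-flip : ∀ N f → antidiagonalSum N f ≈ antidiagonalSum N (flip f)
  antidiagonalSum-flip zero    f = refl
  antidiagonalSum-flip (suc N) f = begin
    f 0 (suc N) + antidiagonalSum N (f ∘ suc)          ≈⟨ +-congˡ (antidiagonalSum-flip N (f ∘ suc)) ⟩
    f 0 (suc N) + antidiagonalSum N (flip (f ∘ suc))   ≈⟨ +-comm _ _ ⟩
    antidiagonalSum N (flip (f ∘ suc)) + f 0 (suc N)   ≈⟨ antidiagonalSum-sucʳ N (flip f) ⟨
    antidiagonalSum (suc N) (flip f)                   ∎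

  sumTo≈antidiagonalSum : ∀ N {h f} → (∀ i j → i ℕ.+ j ≡ N → h i ≈ f i j) →
                          sumTo R N h ≈ antidiagonalSum N f
  sumTo≈antidiagonalSum zero            h≈f = h≈f 0 0 ≡.refl
  sumTo≈antidiagonalSum (suc N) {h} {f} h≈f = begin
    sumTo R (suc N) h          ≈⟨ sumTo-suc N h ⟩
    h 0 + sumTo R N (h ∘ suc)  ≈⟨ +-cong (h≈f 0 (suc N) ≡.refl) tail≈ ⟩
    antidiagonalSum (suc N) f  ∎
    where
    tail≈ : sumTo R N (h ∘ suc) ≈ antidiagonalSum N (f ∘ suc)
    tail≈ = sumTo≈antidiagonalSum N (λ i j e → h≈f (suc i) j (≡.cong suc e))

  module _ (q : Carrier) where

    private
      weight : ℕ → ℕ → Carrier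
      weight i j = pow R q (diffChoose2 i j)

      G : ℕ → ℕ → Carrier
      G = gauss R (q · q)

    gaussConvolution : ℕ → ℕ → ℕ → Carrier
    gaussConvolution a b N = antidiagonalSum N (λ i j → weight i j · (G a i · G b j))

    gaussConvolution-n-0≈1 : ∀ a b → gaussConvolution a b 0 ≈ 1#
    gaussConvolution-n-0≈1 a b = begin
      1# · (G a 0 · G b 0)  ≈⟨ *-identityˡ _ ⟩
      G a 0 · G b 0         ≡⟨ ≡.cong₂ _·_ (gauss-n-0≡1 (q · q) a) (gauss-n-0≡1 (q · q) b) ⟩
      1# · 1#               ≈⟨ *-identityˡ 1# ⟩
      1#                    ∎

    gaussConvolution-0-suc≈0 : ∀ N → gaussConvolution 0 0 (suc N) ≈ 0#
    gaussConvolution-0-suc≈0 N = antidiagonalSum-zero (suc N) vanishes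
      where
      vanishes : ∀ i j → i ℕ.+ j ≡ suc N → weight i j · (G 0 i · G 0 j) ≈ 0#
      vanishes zero    (suc j) _ = factor-zeroʳ refl
      vanishes (suc i) j       _ = factor-zeroˡ refl

    weight-swap : ∀ i j → weight j i · pow R (q · q) j ≈ pow R q (i ℕ.+ j) · weight i j
    weight-swap i j = begin
      weight j i · pow R (q · q) j               ≈⟨ *-congˡ (pow-square q j) ⟩
      weight j i · pow R q (j ℕ.+ j)             ≈⟨ *-comm _ _ ⟩
      pow R q (j ℕ.+ j) · weight j i             ≈⟨ pow-homo-* q (j ℕ.+ j) (diffChoose2 j i) ⟨
      pow R q ((j ℕ.+ j) ℕ.+ diffChoose2 j i)    ≡⟨ ≡.cong (pow R q) (diffChoose2-swap i j) ⟩
      pow R q ((i ℕ.+ j) ℕ.+ diffChoose2 i j)    ≈⟨ pow-homo-* q (i ℕ.+ j) (diffChoose2 i j) ⟩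
      pow R q (i ℕ.+ j) · weight i j             ∎

    gaussConvolution-pascal : ∀ a b N →
      gaussConvolution (suc b) a (suc N) ≈
      gaussConvolution a b N + pow R q (suc N) · gaussConvolution a b (suc N)
    gaussConvolution-pascal a b N = begin
      gaussConvolution (suc b) a (suc N)
        ≈⟨ +-cong head≈ (antidiagonalSum-cong N (λ i j _ → split i j)) ⟩
      second 0 (suc N) + antidiagonalSum N (λ i j → first i j + second (suc i) j)
        ≈⟨ +-congˡ (antidiagonalSum-distrib-+ N first (second ∘ suc)) ⟩
      second 0 (suc N) + (antidiagonalSum N first + antidiagonalSum N (second ∘ suc))
        ≈⟨ x∙yz≈y∙xz _ _ _ ⟩
      antidiagonalSum N first + antidiagonalSum (suc N) second
        ≈⟨ +-cong first-sum second-sum ⟩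
      gaussConvolution a b N + pow R q (suc N) · gaussConvolution a b (suc N) ∎
      where
      first second : ℕ → ℕ → Carrier
      first  i j = weight (suc i) j · (G b i · G a j)
      second i j = weight i j · (pow R (q · q) i · (G b i · G a j))

      head≈ : weight 0 (suc N) · (G (suc b) 0 · G a (suc N)) ≈ second 0 (suc N)
      head≈ = *-congˡ (*-congˡ (begin
        G a (suc N)          ≈⟨ *-identityˡ _ ⟨
        1# · G a (suc N)     ≡⟨ ≡.cong (_· G a (suc N)) (gauss-n-0≡1 (q · q) b) ⟨
        G b 0 · G a (suc N)  ∎))

      split : ∀ i j → weight (suc i) j · (G (suc b) (suc i) · G a j) ≈ first i j + second (suc i) j
      split i j = begin
        weight (suc i) j · ((G b i + pow R (q · q) (suc i) · G b (suc i)) · G a j)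
          ≈⟨ *-congˡ (distribʳ _ _ _) ⟩
        weight (suc i) j · (G b i · G a j + (pow R (q · q) (suc i) · G b (suc i)) · G a j)
          ≈⟨ distribˡ _ _ _ ⟩
        first i j + weight (suc i) j · ((pow R (q · q) (suc i) · G b (suc i)) · G a j)
          ≈⟨ +-congˡ (*-congˡ (*-assoc _ _ _)) ⟩
        first i j + second (suc i) j ∎

      first-sum : antidiagonalSum N first ≈ gaussConvolution a b N
      first-sum = trans (antidiagonalSum-flip N first) (antidiagonalSum-cong N (λ i j _ →
        *-cong (reflexive (≡.cong (pow R q) (diffChoose2-reflect j i))) (*-comm _ _)))

      second-flipped : ∀ i j → i ℕ.+ j ≡ suc N →
                       second j i ≈ pow R q (suc N) · (weight i j · (G a i · G b j))
      second-flipped i j i+j≡N+1 = begin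
        weight j i · (pow R (q · q) j · (G b j · G a i))    ≈⟨ *-assoc _ _ _ ⟨
        (weight j i · pow R (q · q) j) · (G b j · G a i)    ≈⟨ *-cong (weight-swap i j) (*-comm _ _) ⟩
        (pow R q (i ℕ.+ j) · weight i j) · (G a i · G b j)  ≈⟨ *-assoc _ _ _ ⟩
        pow R q (i ℕ.+ j) · (weight i j · (G a i · G b j))
          ≈⟨ *-congʳ (reflexive (≡.cong (pow R q) i+j≡N+1)) ⟩
        pow R q (suc N) · (weight i j · (G a i · G b j))    ∎

      second-sum : antidiagonalSum (suc N) second ≈ pow R q (suc N) · gaussConvolution a b (suc N)
      second-sum = begin
        antidiagonalSum (suc N) second
          ≈⟨ antidiagonalSum-flip (suc N) second ⟩
        antidiagonalSum (suc N) (flip second)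
          ≈⟨ antidiagonalSum-cong (suc N) second-flipped ⟩
        antidiagonalSum (suc N) (λ i j → pow R q (suc N) · (weight i j · (G a i · G b j)))
          ≈⟨ *-distribˡ-antidiagonalSum (suc N) _ (λ i j → weight i j · (G a i · G b j)) ⟨
        pow R q (suc N) · gaussConvolution a b (suc N) ∎

    gaussConvolution-halves : ∀ n N → gaussConvolution ⌈ n /2⌉ ⌊ n /2⌋ N ≈ gauss R q n N
    gaussConvolution-halves zero    zero    = gaussConvolution-n-0≈1 0 0
    gaussConvolution-halves zero    (suc N) = gaussConvolution-0-suc≈0 N
    gaussConvolution-halves (suc n) zero    = gaussConvolution-n-0≈1 (suc ⌊ n /2⌋) ⌈ n /2⌉
    gaussConvolution-halves (suc n) (suc N) = begin
      gaussConvolution (suc ⌊ n /2⌋) ⌈ n /2⌉ (suc N)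
        ≈⟨ gaussConvolution-pascal ⌈ n /2⌉ ⌊ n /2⌋ N ⟩
      gaussConvolution ⌈ n /2⌉ ⌊ n /2⌋ N + pow R q (suc N) · gaussConvolution ⌈ n /2⌉ ⌊ n /2⌋ (suc N)
        ≈⟨ +-cong (gaussConvolution-halves n N) (*-congˡ (gaussConvolution-halves n (suc N))) ⟩
      gauss R q n N + pow R q (suc N) · gauss R q n (suc N) ∎

    gTerm-antidiagonal : ∀ n K i j → i ℕ.+ j ≡ K ℕ.+ K →
                         gTerm R q n (+ K) i ≈ weight i j · (G ⌈ n /2⌉ i · G ⌊ n /2⌋ j)
    gTerm-antidiagonal n K i j i+j≡K+K = reflexive (≡.cong₂ _·_
      (≡.cong (pow R q) (centred-exponent i j K i+j≡K+K))
      (≡.cong₂ _·_ (≡.cong (gaussℤ R (q · q) ⌈ n /2⌉) (i+[j-i]≡j (+ K) (+ i)))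
                   (≡.cong (gaussℤ R (q · q) ⌊ n /2⌋) (centred-difference i j K i+j≡K+K))))

    gTerm-vanishes-beyond-⌈n/2⌉ : ∀ n k d → gTerm R q n k (suc d ℕ.+ ⌈ n /2⌉) ≈ 0#
    gTerm-vanishes-beyond-⌈n/2⌉ n k d = factor-zeroˡ (trans
      (reflexive (≡.cong (gaussℤ R (q · q) ⌈ n /2⌉) (i+[j-i]≡j k (+ (suc d ℕ.+ ⌈ n /2⌉)))))
      (n<k⇒gauss≈0 (q · q) (s≤s (ℕ.m≤n+m ⌈ n /2⌉ d))))

    gTerm-vanishes-beyond-2K : ∀ n K d → gTerm R q n (+ K) (suc d ℕ.+ (K ℕ.+ K)) ≈ 0#
    gTerm-vanishes-beyond-2K n K d =
      factor-zeroʳ (reflexive (≡.cong (gaussℤ R (q · q) ⌊ n /2⌋) (identity (+ d) (+ K))))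
      where
      identity : ∀ x k → k ℤ.- ((+ 1 ℤ.+ x ℤ.+ (k ℤ.+ k)) ℤ.- k) ≡ ℤ.- (+ 1 ℤ.+ x)
      identity = solve-∀

    gTerm-negsuc : ∀ n K i → gTerm R q n ℤ.-[1+ K ] i ≈ 0#
    gTerm-negsuc n K i =
      factor-zeroʳ (reflexive (≡.cong (gaussℤ R (q · q) ⌊ n /2⌋) (identity (+ K) (+ i))))
      where
      identity : ∀ k x → ℤ.- (+ 1 ℤ.+ k) ℤ.- (x ℤ.- ℤ.- (+ 1 ℤ.+ k))
                       ≡ ℤ.- (+ 1 ℤ.+ (+ 1 ℤ.+ k ℤ.+ (k ℤ.+ x)))
      identity = solve-∀

    g-pos : ∀ n K → g R q n (+ K) ≈ gauss R q n (K ℕ.+ K)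
    g-pos n K = begin
      sumTo R ⌈ n /2⌉ (gTerm R q n (+ K))
        ≈⟨ sumTo-resize ⌈ n /2⌉ (K ℕ.+ K) (gTerm-vanishes-beyond-⌈n/2⌉ n (+ K))
                                          (gTerm-vanishes-beyond-2K n K) ⟩
      sumTo R (K ℕ.+ K) (gTerm R q n (+ K))
        ≈⟨ sumTo≈antidiagonalSum (K ℕ.+ K) (gTerm-antidiagonal n K) ⟩
      gaussConvolution ⌈ n /2⌉ ⌊ n /2⌋ (K ℕ.+ K)
        ≈⟨ gaussConvolution-halves n (K ℕ.+ K) ⟩
      gauss R q n (K ℕ.+ K) ∎

    g-negsuc : ∀ n K → g R q n ℤ.-[1+ K ] ≈ 0#
    g-negsuc n K = sumTo-zero ⌈ n /2⌉ (gTerm-negsuc n K)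

mainTheorem5 : {c ℓ : Level} (R : CommutativeRing c ℓ) (q : CommutativeRing.Carrier R)
    → (n : ℕ) (k : ℤ)
    → CommutativeRing._≈_ R (g R q n k) (gaussℤ R q n (+ 2 * k))
mainTheorem5 R q n (+ K) = begin
    g R q n (+ K)             ≈⟨ g-pos R q n K ⟩
    gauss R q n (K ℕ.+ K)     ≡⟨ ≡.cong (gaussℤ R q n) (double≡2* (+ K)) ⟩
    gaussℤ R q n (+ 2 * + K)  ∎
  where
  open SetoidReasoning (CommutativeRing.setoid R)
  double≡2* : ∀ x → x ℤ.+ x ≡ + 2 * x
  double≡2* = solve-∀
mainTheorem5 R q n ℤ.-[1+ K ] = g-negsuc R q n K
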